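{- Let $A$ be a setoid and $B$ a setoid family over $A$. Then the $P_B$-algebra $\mathsf{s} : P_B W \Rightarrow W$ is initial: for every setoid $C$ and every extensional function $a_C : P_B C \Rightarrow C$, there is an element $h$ of $\mathsf{Alg}_B(\mathsf{s},a_C)$ such that $h \approx h'$ for every $h'$ in $\mathsf{Alg}_B(\mathsf{s},a_C)$. That is, the type \[\prod_{A,\,B}\ \prod_{C,\,a_C}\ \sum_{h : \mathsf{Alg}_B(\mathsf{s},a_C)}\ \prod_{h' : \mathsf{Alg}_B(\mathsf{s},a_C)} h \approx h'\] is inhabited.
   Context: Setting: intensional Martin-Löf type theory with $\Pi$-types and a universe $\mathsf{U}$ closed under $\Pi$-types and containing intensional $\Sigma$-types, intensional identity types, the unit type, W-types and dependent W-types (inductive families). Logic is propositions-as-types: a statement holds when the corresponding type is inhabited. A setoid $X$ is a tuple $(X_0,\approx_X,r_X,s_X,t_X)$ with $X_0:\mathsf{U}$, $\approx_X : X_0\to X_0\to\mathsf{U}$ and terms $r_X,s_X,t_X$ witnessing reflexivity, symmetry and transitivity of $\approx_X$; $x:X$ means $x:X_0$. An extensional function $f:X\Rightarrow Y$ is a pair of $f_0:X_0\to Y_0$ and a term of $\prod_{x,x'}x\approx_X x'\to f_0\,x\approx_Y f_0\,x'$; these form a setoid $X\Rightarrow Y$ with $f\approx g := \prod_x f_0\,x\approx_Y g_0\,x$. Composition is written $\circ$. A setoid family $B$ over a setoid $A$ assigns a setoid $B\,a$ (underlying type $B_0\,a$) to each $a:A$ and an extensional "transport" $B_\alpha : B\,a\Rightarrow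 B\,a'$ to each $\alpha : a\approx_A a'$, functorially up to $\approx$ and with $B_\alpha\approx B_{\alpha'}$ for all $\alpha,\alpha' : a\approx_A a'$ (a functor from the discrete groupoid on $A$ to setoids). Write $b\approx_\alpha b'$ for $B_\alpha\,b\approx_{B\,a'} b'$. The polynomial functor $P_B$ sends a setoid $X$ to the setoid with underlying type $\sum_{a:A_0}(B\,a\Rightarrow X)$ and equality $(a,k)\approx(a',k') := \sum_{\alpha:a\approx_A a'} k\approx k'\circ B_\alpha$, and sends $f:X\Rightarrow Y$ to $(a,k)\mapsto(a,f\circ k)$. The setoid $W$: let $\mathrm{W}$ be the W-type on $A_0$ and $B_0$, with constructor $\mathsf{sup}\,a\,f$ ($a:A_0$, $f:B_0\,a\to\mathrm{W}$) and with $\mathsf{n}:\mathrm{W}\to A_0$, $\mathsf{b}:\prod_w B_0(\mathsf{n}\,w)\to\mathrm{W}$ given by $\mathsf{n}(\mathsf{sup}\,a\,f)\equiv a$, $\mathsf{b}(\mathsf{sup}\,a\,f)\equiv f$. Let $\mathcal{W}_B:\mathrm{W}\to\mathrm{W}\to\mathsf{U}$ be the inductive family (dependent W-type indexed by $\mathrm{W}\times\mathrm{W}$) with the single constructor: for $w,w':\mathrm{W}$, $\alpha:\mathsf{n}\,w\approx_A\mathsf{n}\,w'$ and $\phi:\prod_{z:\sum_{b:B_0(\mathsf{n} w)}\sum_{b':B_0(\mathsf{n} w')} b\approx_\alpha b'}\mathcal{W}_B\,(\mathsf{b}\,w\,(\mathrm{pr}_1 z))\,(\mathsf{b}\,w'\,(\mathrm{pr}_2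 z))$, one has $\mathsf{dsup}\,(w,w')\,\alpha\,\phi:\mathcal{W}_B\,w\,w'$. The setoid $W$ has underlying type $\sum_{w:\mathrm{W}}\mathcal{W}_B\,w\,w$ and equality $(w,\_)\approx_W(w',\_):=\mathcal{W}_B\,w\,w'$. The algebra map $\mathsf{s}:P_BW\Rightarrow W$ sends $(a,f)$ to the tree $\mathsf{sup}\,a\,(\lambda b.\,\mathrm{pr}_1(f_0\,b))$ together with a proof that it lies in $W$. For a $P_B$-algebra $(C,a_C)$ (a setoid $C$ with extensional $a_C:P_BC\Rightarrow C$), $\mathsf{Alg}_B(\mathsf{s},a_C)$ is the setoid of pairs $(h,p)$ with $h:W\Rightarrow C$ and $p : h\circ\mathsf{s}\approx a_C\circ(P_B\,h)$, with $(h,\_)\approx(h',\_):=h\approx h'$. -}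

module Defs where

open import Level using (0ℓ)
open import Data.Product using (Σ; Σ-syntax; _,_; proj₁; proj₂)
open import Relation.Binary.Bundles using (Setoid)
open import Function.Bundles using (Func; _⟨$⟩_)
import Function.Relation.Binary.Setoid.Equality as FunEq

-- All setoids have carrier and equality in the base universe  Set  (playing U).
Setoid₀ : Set₁
Setoid₀ = Setoid 0ℓ 0ℓ

∣_∣ : Setoid₀ → Set
∣ X ∣ = Setoid.Carrier X

_⇒_ : Setoid₀ → Setoid₀ → Set
X ⇒ Y = Func X Y

_⇨_ : Setoid₀ → Setoid₀ → Setoid₀
X ⇨ Y = FunEq.setoid X Y

_≈ᶠ_ : {X Y : Setoid₀} → X ⇒ Y → X ⇒ Y → Set
_≈ᶠ_ {X} {Y} f g = Setoid._≈_ (X ⇨ Y) f g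

idᶠ : {X : Setoid₀} → X ⇒ X
idᶠ = record { to = λ x → x ; cong = λ p → p }

infixr 9 _∘ᶠ_
_∘ᶠ_ : {X Y Z : Setoid₀} → Y ⇒ Z → X ⇒ Y → X ⇒ Z
g ∘ᶠ f = record { to = λ x → g ⟨$⟩ (f ⟨$⟩ x)
                ; cong = λ p → Func.cong g (Func.cong f p) }

-- A setoid family over A: a functor from the discrete groupoid on A to setoids.
record SetoidFamily (A : Setoid₀) : Set₁ where
  open Setoid A using (refl; trans) renaming (_≈_ to _≈A_)
  field
    Fam   : ∣ A ∣ → Setoid₀
    tr    : {a a' : ∣ A ∣} → a ≈A a' → Fam a ⇒ Fam a'
    tr-id : {a : ∣ A ∣} → tr (refl {a}) ≈ᶠ idᶠ
    tr-∘  : {a a' a'' : ∣ A ∣} (α : a ≈A a') (β : a' ≈A a'') →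
            tr (trans α β) ≈ᶠ (tr β ∘ᶠ tr α)
    tr-irr : {a a' : ∣ A ∣} (α α' : a ≈A a') → tr α ≈ᶠ tr α'

  Fam₀ : ∣ A ∣ → Set
  Fam₀ a = ∣ Fam a ∣

  _≈[_]_ : {a a' : ∣ A ∣} → Fam₀ a → a ≈A a' → Fam₀ a' → Set
  b ≈[ α ] b' = Setoid._≈_ (Fam _) (tr α ⟨$⟩ b) b'

module _ {A : Setoid₀} (B : SetoidFamily A) where
  open Setoid A using () renaming (_≈_ to _≈A_; refl to reflA; sym to symA; trans to transA)
  open SetoidFamily B

  private
    module Fa {a} = Setoid (Fam a)

    tr-sym-inv : {a a' : ∣ A ∣} (α : a ≈A a') (b' : Fam₀ a') →
                 Setoid._≈_ (Fam a') (tr α ⟨$⟩ (tr (symA α) ⟨$⟩ b')) b'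
    tr-sym-inv α b' = Fa.trans (Fa.sym (tr-∘ (symA α) α b'))
                        (Fa.trans (tr-irr (transA (symA α) α) reflA b') (tr-id b'))

  P : Setoid₀ → Setoid₀
  P X = record
    { Carrier = Σ[ a ∈ ∣ A ∣ ] (Fam a ⇒ X)
    ; _≈_ = λ { (a , k) (a' , k') → Σ[ α ∈ a ≈A a' ] (k ≈ᶠ (k' ∘ᶠ tr α)) }
    ; isEquivalence = record
      { refl = λ { {a , k} → reflA , λ b → Func.cong k (Fa.sym (tr-id b)) }
      ; sym = λ { {a , k} {a' , k'} (α , e) → symA α , λ b' →
                X.trans (Func.cong k' (Fa.sym (tr-sym-inv α b')))
                        (X.sym (e (tr (symA α) ⟨$⟩ b'))) }
      ; trans = λ { {a , k} {a' , k'} {a'' , k''} (α , e) (β , e') → transA α β , λ b →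
                X.trans (e b) (X.trans (e' (tr α ⟨$⟩ b))
                        (Func.cong k'' (Fa.sym (tr-∘ α β b)))) }
      }
    }
    where module X = Setoid X

  Pmap : {X Y : Setoid₀} → X ⇒ Y → P X ⇒ P Y
  Pmap f = record
    { to = λ { (a , k) → a , (f ∘ᶠ k) }
    ; cong = λ { (α , e) → α , λ b → Func.cong f (e b) }
    }

  data 𝕎 : Set where
    sup : (a : ∣ A ∣) → (Fam₀ a → 𝕎) → 𝕎

  n : 𝕎 → ∣ A ∣
  n (sup a f) = a

  bW : (w : 𝕎) → Fam₀ (n w) → 𝕎
  bW (sup a f) = f

  data 𝒲 : 𝕎 → 𝕎 → Set where
    dsup : (w w' : 𝕎) (α : n w ≈A n w') →
           ((z : Σ[ b ∈ Fam₀ (n w) ] Σ[ b' ∈ Fam₀ (n w') ] (b ≈[ α ] b')) →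
              𝒲 (bW w (proj₁ z)) (bW w' (proj₁ (proj₂ z)))) →
           𝒲 w w'

  private
    𝒲-sym : {w w' : 𝕎} → 𝒲 w w' → 𝒲 w' w
    𝒲-sym (dsup w w' α φ) = dsup w' w (symA α) λ { (b' , b , p) →
      𝒲-sym (φ (b , b' , Fa.trans (Func.cong (tr α) (Fa.sym p)) (tr-sym-inv α b'))) }

    𝒲-trans : {w w' w'' : 𝕎} → 𝒲 w w' → 𝒲 w' w'' → 𝒲 w w''
    𝒲-trans (dsup w w' α φ) (dsup .w' w'' β ψ) = dsup w w'' (transA α β) λ { (b , b'' , p) →
      𝒲-trans (φ (b , tr α ⟨$⟩ b , Fa.refl))
              (ψ (tr α ⟨$⟩ b , b'' , Fa.trans (Fa.sym (tr-∘ α β b)) p)) }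

  Wˢ : Setoid₀
  Wˢ = record
    { Carrier = Σ[ w ∈ 𝕎 ] 𝒲 w w
    ; _≈_ = λ x y → 𝒲 (proj₁ x) (proj₁ y)
    ; isEquivalence = record
      { refl = λ { {w , p} → p }
      ; sym = 𝒲-sym
      ; trans = 𝒲-trans
      }
    }

  s : P Wˢ ⇒ Wˢ
  s = record
    { to = λ { (a , f) → sup a (λ b → proj₁ (f ⟨$⟩ b))
                       , dsup (sup a (λ b → proj₁ (f ⟨$⟩ b))) (sup a (λ b → proj₁ (f ⟨$⟩ b)))
                              reflA (λ { (b , b' , p) →
                                Func.cong f (Fa.trans (Fa.sym (tr-id b)) p) }) }
    ; cong = λ { {a , f} {a' , f'} (α , e) →
        dsup (sup a (λ b → proj₁ (f ⟨$⟩ b))) (sup a' (λ b → proj₁ (f' ⟨$⟩ b))) α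
             (λ { (b , b' , p) → 𝒲-trans (e b) (Func.cong f' p) }) }
    }

  Alg : (C : Setoid₀) → P C ⇒ C → Setoid₀
  Alg C aC = record
    { Carrier = Σ[ h ∈ Wˢ ⇒ C ] ((h ∘ᶠ s) ≈ᶠ (aC ∘ᶠ Pmap h))
    ; _≈_ = λ x y → proj₁ x ≈ᶠ proj₁ y
    ; isEquivalence = record
      { refl = λ {x} → Setoid.refl (Wˢ ⇨ C) {proj₁ x}
      ; sym = λ {x} {y} → Setoid.sym (Wˢ ⇨ C) {proj₁ x} {proj₁ y}
      ; trans = λ {x} {y} {z} → Setoid.trans (Wˢ ⇨ C) {proj₁ x} {proj₁ y} {proj₁ z}
      }
    }

-- We define
-- the map W ⇒ C by structural recursion on the tree, simultaneously with
-- its extensionality (rec-cong), by induction on the inductive family 𝒲.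
-- The defining clause of rec is the homomorphism equation up to the
-- choice of reflexivity proofs, which rec-cong shows to be irrelevant.
--
-- Uniqueness: every element (sup a f , p) of W is s applied to its
-- extensional family of immediate subtrees (s-subtrees).  Hence any two
-- algebra morphisms h, h' agree on (sup a f , p) as soon as they agree on
-- its subtrees, and they agree everywhere by induction on trees
-- (morphisms-agree).
module Submission where

open import Defs
open import Data.Product using (Σ-syntax; _,_; proj₁; proj₂)
open import Relation.Binary.Bundles using (Setoid)
open import Function.Bundles using (Func; _⟨$⟩_)
import Relation.Binary.Reasoning.Setoid as SetoidReasoning

module _ {A : Setoid₀} (B : SetoidFamily A) where
  open Setoid A using () renaming (_≈_ to _≈A_; refl to reflA)
  open SetoidFamily B
  private
    module Fa {a} = Setoid (Fam a)
    module Ws = Setoid (Wˢ B)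

  -- Transport along a loop is the identity, since all proofs of a ≈ a
  -- induce the same transport as reflexivity.
  loop-tr : {a : ∣ A ∣} (α : a ≈A a) (b : Fam₀ a) → b ≈[ α ] b
  loop-tr α b = Fa.trans (tr-irr α reflA b) (tr-id b)

  P-pointwise : {X : Setoid₀} {a : ∣ A ∣} {k k' : Fam a ⇒ X} →
                ((b : Fam₀ a) → Setoid._≈_ X (k ⟨$⟩ b) (k' ⟨$⟩ b)) →
                Setoid._≈_ (P B X) (a , k) (a , k')
  P-pointwise {X} {k' = k'} e = reflA , λ b →
    Setoid.trans X (e b) (Func.cong k' (Fa.sym (tr-id b)))

  -- The immediate subtrees of an element (sup a f , p) of W, as an
  -- extensional function into W; the proof p supplies both the
  -- reflexivity proofs of the subtrees and the extensionality.
  subtrees : (a : ∣ A ∣) (f : Fam₀ a → 𝕎 B) → 𝒲 B (sup a f) (sup a f) →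
             Fam a ⇒ Wˢ B
  subtrees a f (dsup _ _ α φ) = record
    { to   = λ b → f b , φ (b , b , loop-tr α b)
    ; cong = λ {b} {b'} e → φ (b , b' , Fa.trans (loop-tr α b) e) }

  s-subtrees : (a : ∣ A ∣) (f : Fam₀ a → 𝕎 B) (p : 𝒲 B (sup a f) (sup a f)) →
               s B ⟨$⟩ (a , subtrees a f p) Ws.≈ (sup a f , p)
  s-subtrees a f p@(dsup _ _ _ _) = p

  module _ (C : Setoid₀) (aC : P B C ⇒ C) where
    private
      module Cs = Setoid C

    aC-pointwise : {a : ∣ A ∣} {k k' : Fam a ⇒ C} →
                   ((b : Fam₀ a) → k ⟨$⟩ b Cs.≈ k' ⟨$⟩ b) →
                   aC ⟨$⟩ (a , k) Cs.≈ aC ⟨$⟩ (a , k')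
    aC-pointwise {k = k} {k'} e = Func.cong aC (P-pointwise {C} {k = k} {k'} e)

    rec : (w : 𝕎 B) → 𝒲 B w w → ∣ C ∣
    rec-cong : (w w' : 𝕎 B) (p : 𝒲 B w w) (p' : 𝒲 B w' w') → 𝒲 B w w' →
               rec w p Cs.≈ rec w' p'

    rec (sup a f) (dsup _ _ α φ) = aC ⟨$⟩ (a , record
      { to   = λ b → rec (f b) (φ (b , b , loop-tr α b))
      ; cong = λ {b} {b'} e → rec-cong (f b) (f b') _ _
                                (φ (b , b' , Fa.trans (loop-tr α b) e)) })
    rec-cong (sup a f) (sup a' f') (dsup _ _ _ _) (dsup _ _ _ _) (dsup _ _ β ψ) =
      Func.cong aC (β , λ b → rec-cong (f b) (f' (tr β ⟨$⟩ b)) _ _ (ψ (b , _ , Fa.refl)))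

    fold : Wˢ B ⇒ C
    fold = record { to   = λ x → rec (proj₁ x) (proj₂ x)
                  ; cong = λ {x} {y} → rec-cong (proj₁ x) (proj₁ y) (proj₂ x) (proj₂ y) }

    -- fold is an algebra morphism: both sides apply aC to the same
    -- family of recursive values, computed from different reflexivity
    -- proofs of the subtrees.
    fold-hom : (fold ∘ᶠ s B) ≈ᶠ (aC ∘ᶠ Pmap B fold)
    fold-hom (a , g) = aC-pointwise (λ b →
      rec-cong _ _ _ (proj₂ (g ⟨$⟩ b)) (proj₂ (g ⟨$⟩ b)))

    morphisms-agree : (h h' : Setoid.Carrier (Alg B C aC)) →
                      Setoid._≈_ (Alg B C aC) h h'
    morphisms-agree (h , hom) (h' , hom') (w , p) = agree w p
      where
      agree : (w : 𝕎 B) (p : 𝒲 B w w) → h ⟨$⟩ (w , p) Cs.≈ h' ⟨$⟩ (w , p)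
      agree (sup a f) p@(dsup _ _ α φ) = begin
        h ⟨$⟩ (sup a f , p)                  ≈⟨ Func.cong h (Ws.sym {s B ⟨$⟩ (a , sub)} {sup a f , p}
                                                                (s-subtrees a f p)) ⟩
        h ⟨$⟩ (s B ⟨$⟩ (a , sub))            ≈⟨ hom (a , sub) ⟩
        aC ⟨$⟩ (a , h ∘ᶠ sub)                ≈⟨ aC-pointwise (λ b → agree (f b) (φ (b , b , loop-tr α b))) ⟩
        aC ⟨$⟩ (a , h' ∘ᶠ sub)               ≈⟨ Cs.sym (hom' (a , sub)) ⟩
        h' ⟨$⟩ (s B ⟨$⟩ (a , sub))           ≈⟨ Func.cong h' (s-subtrees a f p) ⟩
        h' ⟨$⟩ (sup a f , p)                 ∎
        where
        open SetoidReasoning C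
        sub : Fam a ⇒ Wˢ B
        sub = subtrees a f p

theorem3p18 : (A : Setoid₀) (B : SetoidFamily A) (C : Setoid₀) (aC : P B C ⇒ C) →
    Σ[ h ∈ Setoid.Carrier (Alg B C aC) ] ((h' : Setoid.Carrier (Alg B C aC)) → Setoid._≈_ (Alg B C aC) h h')
theorem3p18 A B C aC = initial , morphisms-agree B C aC initial
  where
  initial : Setoid.Carrier (Alg B C aC)
  initial = fold B C aC , fold-hom B C aC
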